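{- Let $x$ and $y$ be representations of a countable set $A$ with $\mathrm{comp}(x)\subseteq\mathrm{comp}(y)$. If $x(A)$ is computationally enumerable, then so is $y(A)$.
   Context: $\mathbb{T}$ denotes the set of tapes over a fixed finite alphabet with finitely many non-blank symbols. For $Q\subseteq\mathbb{T}$, a function with domain $Q$ and values in $\mathbb{T}$ is computable if some Turing machine, on every input $\tau\in Q$, halts with output equal to the function's value (nothing is required outside $Q$). A set $Q\subseteq\mathbb{T}$ is computationally enumerable (c.e.) if there is a computable function $h$ with domain $Q$ and values in $Q$ and a tape $\tau_0\in Q$ such that each $\tau\in Q$ equals $h^i(\tau_0)$ for some $i\in\mathbb{N}$ (equivalently, some Turing machine halts exactly on the tapes of $Q$). A representation of $A$ is an injective function $A\to\mathbb{T}$; for a representation $x$, $\mathrm{comp}(x)$ is the set of functions $g$ with domain $A$ and values in $A$ such that $x\circ g\circ x^{ -1}$ (defined on $x(A)$) is computable. -}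

module Defs where

open import Data.Nat using (ℕ; zero; suc)
open import Data.Fin using (Fin; zero; suc)
open import Data.Bool using (Bool; true; false; not; T; if_then_else_)
open import Data.List using (List; []; _∷_)
open import Data.Maybe using (Maybe; just; nothing)
open import Data.Product using (Σ; ∃; ∃-syntax; _×_; _,_; proj₁; proj₂)
open import Relation.Binary.PropositionalEquality using (_≡_; refl)
open import Function.Definitions using (Injective)

Sym : ℕ → Set
Sym k = Fin (suc k)

blank : ∀ {k} → Sym k
blank = zero

isBlank : ∀ {k} → Sym k → Bool
isBlank zero    = true
isBlank (suc _) = false

trimmed : ∀ {k} → List (Sym k) → Bool
trimmed []           = true
trimmed (x ∷ [])     = not (isBlank x)
trimmed (x ∷ y ∷ l)  = trimmed (y ∷ l)

strip : ∀ {k} → List (Sym k) → List (Sym k)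
strip [] = []
strip (x ∷ l) with strip l
... | []    = if isBlank x then [] else x ∷ []
... | y ∷ r = x ∷ y ∷ r

strip-trimmed : ∀ {k} (l : List (Sym k)) → T (trimmed (strip l))
strip-trimmed [] = _
strip-trimmed (x ∷ l) with strip l | strip-trimmed l
strip-trimmed (zero ∷ l)  | [] | _ = _
strip-trimmed (suc x ∷ l) | [] | _ = _
... | y ∷ r | p = p

-- Tapes: a (canonical) tape with finitely many non-blank symbols.
-- 'right' lists the cells 0,1,2,..., 'left' lists the cells -1,-2,...;
-- both lists have no trailing blanks, so tapes with the same content are
-- equal (≡).

record Tape (k : ℕ) : Set where
  constructor mkTape
  field
    left  : List (Sym k)
    right : List (Sym k)
    leftOK  : T (trimmed left)
    rightOK : T (trimmed right)

-- Turing machines (one two-way infinite tape, states Fin (suc n),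
-- start state zero; a machine halts when the transition is undefined).

data Move : Set where
  L R S : Move

record TM (k : ℕ) : Set where
  field
    nstates : ℕ
    δ : Fin (suc nstates) → Sym k → Maybe (Fin (suc nstates) × Sym k × Move)

-- configuration: state, cells left of the head (nearest first),
-- the scanned cell, cells right of the head (nearest first)
record Config {k : ℕ} (M : TM k) : Set where
  constructor ⟨_,_,_,_⟩
  field
    state : Fin (suc (TM.nstates M))
    lefts : List (Sym k)
    cur   : Sym k
    rights : List (Sym k)

hd : ∀ {k} → List (Sym k) → Sym k
hd []      = blank
hd (x ∷ _) = x

tl : ∀ {k} → List (Sym k) → List (Sym k)
tl []      = []
tl (_ ∷ l) = l

step : ∀ {k} (M : TM k) → Config M → Maybe (Config M)
step M ⟨ q , ls , c , rs ⟩ with TM.δ M q c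
... | nothing = nothing
... | just (q' , s , L) = just ⟨ q' , tl ls , hd ls , s ∷ rs ⟩
... | just (q' , s , R) = just ⟨ q' , s ∷ ls , hd rs , tl rs ⟩
... | just (q' , s , S) = just ⟨ q' , ls , s , rs ⟩

initial : ∀ {k} (M : TM k) → Tape k → Config M
initial M τ = ⟨ zero , Tape.left τ , hd (Tape.right τ) , tl (Tape.right τ) ⟩

-- output: the tape content, read relative to the final head position
output : ∀ {k} {M : TM k} → Config M → Tape k
output ⟨ q , ls , c , rs ⟩ =
  mkTape (strip ls) (strip (c ∷ rs)) (strip-trimmed ls) (strip-trimmed (c ∷ rs))

eval : ∀ {k} (M : TM k) → ℕ → Config M → Maybe (Tape k)
eval M zero c with step M c
... | nothing = just (output c)
... | just _  = nothing
eval M (suc n) c with step M c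
... | nothing = just (output c)
... | just c' = eval M n c'

HaltsWith : ∀ {k} → TM k → Tape k → Tape k → Set
HaltsWith M τ σ = ∃[ n ] eval M n (initial M τ) ≡ just σ

Subset : ℕ → Set₁
Subset k = Tape k → Set

Computable : ∀ {k} (Q : Subset k) → ((τ : Tape k) → Q τ → Tape k) → Set
Computable {k} Q f = ∃[ M ] ((τ : Tape k) (p : Q τ) → HaltsWith M τ (f τ p))

iterQ : ∀ {k} {Q : Subset k} (h : (τ : Tape k) → Q τ → Tape k)
        (hQ : (τ : Tape k) (p : Q τ) → Q (h τ p)) →
        ℕ → Σ (Tape k) Q → Σ (Tape k) Q
iterQ h hQ zero    t = t
iterQ h hQ (suc i) t with iterQ h hQ i t
... | (τ , p) = (h τ p , hQ τ p)

CE : ∀ {k} → Subset k → Set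
CE {k} Q =
  Σ ((τ : Tape k) → Q τ → Tape k) λ h →
  Σ ((τ : Tape k) (p : Q τ) → Q (h τ p)) λ hQ →
  Computable Q h ×
  Σ (Tape k) λ τ₀ → Σ (Q τ₀) λ p₀ →
    (τ : Tape k) → Q τ → ∃[ i ] proj₁ (iterQ h hQ i (τ₀ , p₀)) ≡ τ

Countable : Set → Set
Countable A = Σ (A → ℕ) λ f → Injective _≡_ _≡_ f

IsRepresentation : ∀ {k} {A : Set} → (A → Tape k) → Set
IsRepresentation x = Injective _≡_ _≡_ x

Image : ∀ {k} {A : Set} → (A → Tape k) → Subset k
Image {A = A} x τ = Σ A λ a → x a ≡ τ

-- g ∈ comp(x): x ∘ g ∘ x⁻¹ (on x(A)) is computable
InComp : ∀ {k} {A : Set} → (A → Tape k) → (A → A) → Set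
InComp x g = Computable (Image x) (λ τ p → x (g (proj₁ p)))

module Submission where

-- A representation x identifies A with the set of tapes x(A),
-- so a self-map h of x(A) is the same thing as a self-map g of A
-- "intertwined" with h through x (x ∘ g = h ∘ x).  An enumeration of x(A)
-- by a computable h therefore yields a self-map g of A that lies in
-- comp(x) and whose orbit of a single point a₀ covers all of A.  By the
-- hypothesis comp(x) ⊆ comp(y), g also lies in comp(y), i.e. the conjugate
-- y ∘ g ∘ y⁻¹ is computable on y(A); its orbit of y(a₀) is the image under
-- y of the orbit of a₀, hence all of y(A), so y(A) is c.e.

open import Defs
open import Data.Nat using (ℕ; zero; suc)
open import Data.Nat.GeneralisedArithmetic using (fold)
open import Data.Product using (Σ; ∃; ∃-syntax; _×_; _,_; proj₁; proj₂)
open import Relation.Binary.PropositionalEquality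
  using (_≡_; refl; sym; trans; cong; subst)

module _ {k : ℕ} {A : Set} where

  Enumerates : (A → A) → A → Set
  Enumerates g a₀ = (a : A) → ∃[ i ] fold a₀ g i ≡ a

  Intertwines : (x : A → Tape k) → (A → A) →
                ((τ : Tape k) → Image x τ → Tape k) → Set
  Intertwines x g h = ∀ a τ (p : Image x τ) → x a ≡ τ → h τ p ≡ x (g a)

  conj : (x : A → Tape k) → (A → A) → (τ : Tape k) → Image x τ → Tape k
  conj x g τ p = x (g (proj₁ p))

  conj-closed : (x : A → Tape k) (g : A → A) →
                (τ : Tape k) (p : Image x τ) → Image x (conj x g τ p)
  conj-closed x g τ p = g (proj₁ p) , refl

  conj-intertwines : (x : A → Tape k) → IsRepresentation x →
                     (g : A → A) → Intertwines x g (conj x g)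
  conj-intertwines x injx g a τ (b , xb≡τ) xa≡τ =
    cong (λ c → x (g c)) (injx (trans xb≡τ (sym xa≡τ)))

  iterQ-suc : {Q : Subset k} (h : (τ : Tape k) → Q τ → Tape k)
              (hQ : (τ : Tape k) (p : Q τ) → Q (h τ p))
              (i : ℕ) (t : Σ (Tape k) Q) →
              iterQ h hQ (suc i) t ≡
                (h (proj₁ (iterQ h hQ i t)) (proj₂ (iterQ h hQ i t)) ,
                 hQ (proj₁ (iterQ h hQ i t)) (proj₂ (iterQ h hQ i t)))
  iterQ-suc h hQ i t with iterQ h hQ i t
  ... | (τ , p) = refl

  iterQ-intertwined :
    (x : A → Tape k) (g : A → A)
    (h : (τ : Tape k) → Image x τ → Tape k)
    (hQ : (τ : Tape k) (p : Image x τ) → Image x (h τ p)) →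
    Intertwines x g h →
    (a₀ : A) (τ₀ : Tape k) (p₀ : Image x τ₀) → x a₀ ≡ τ₀ →
    (i : ℕ) → proj₁ (iterQ h hQ i (τ₀ , p₀)) ≡ x (fold a₀ g i)
  iterQ-intertwined x g h hQ hg a₀ τ₀ p₀ xa₀≡τ₀ zero = sym xa₀≡τ₀
  iterQ-intertwined x g h hQ hg a₀ τ₀ p₀ xa₀≡τ₀ (suc i)
    rewrite iterQ-suc h hQ i (τ₀ , p₀) =
      hg (fold a₀ g i) _ (proj₂ (iterQ h hQ i (τ₀ , p₀)))
         (sym (iterQ-intertwined x g h hQ hg a₀ τ₀ p₀ xa₀≡τ₀ i))

  computable-cong : {Q : Subset k} {f f' : (τ : Tape k) → Q τ → Tape k} →
                    (∀ τ p → f τ p ≡ f' τ p) →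
                    Computable Q f → Computable Q f'
  computable-cong f≡f' (M , halts) =
    M , λ τ p → subst (HaltsWith M τ) (f≡f' τ p) (halts τ p)

  ce⇒enumerating-comp : (x : A → Tape k) → IsRepresentation x →
    CE (Image x) → Σ (A → A) λ g → Σ A λ a₀ → InComp x g × Enumerates g a₀
  ce⇒enumerating-comp x injx (h , hQ , h-comp , τ₀ , p₀ , h-enum) =
    g , a₀ , computable-cong conj≡h h-comp , g-enum
    where
    -- g a is the unique preimage of h (x a)
    g : A → A
    g a = proj₁ (hQ (x a) (a , refl))

    a₀ : A
    a₀ = proj₁ p₀

    h-witness : ∀ a τ (p : Image x τ) → x a ≡ τ → h (x a) (a , refl) ≡ h τ p
    h-witness a .(x b) (b , refl) xa≡xb with injx xa≡xb
    ... | refl = refl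

    h-intertwines : Intertwines x g h
    h-intertwines a τ p xa≡τ =
      trans (sym (h-witness a τ p xa≡τ)) (sym (proj₂ (hQ (x a) (a , refl))))

    conj≡h : ∀ τ p → h τ p ≡ conj x g τ p
    conj≡h τ (a , xa≡τ) = h-intertwines a τ (a , xa≡τ) xa≡τ

    g-enum : Enumerates g a₀
    g-enum a with h-enum (x a) (a , refl)
    ... | i , hⁱ≡xa =
      i , injx (trans (sym (iterQ-intertwined x g h hQ h-intertwines
                                  a₀ τ₀ p₀ (proj₂ p₀) i))
                      hⁱ≡xa)

  enumerating-comp⇒ce : (y : A → Tape k) → IsRepresentation y →
    (g : A → A) (a₀ : A) → InComp y g → Enumerates g a₀ → CE (Image y)
  enumerating-comp⇒ce y injy g a₀ g-comp g-enum =
    conj y g , conj-closed y g , g-comp , y a₀ , (a₀ , refl) , enum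
    where
    enum : (τ : Tape k) → Image y τ →
           ∃[ i ] proj₁ (iterQ (conj y g) (conj-closed y g) i (y a₀ , (a₀ , refl))) ≡ τ
    enum τ (a , ya≡τ) with g-enum a
    ... | i , gⁱa₀≡a =
      i , trans (iterQ-intertwined y g (conj y g) (conj-closed y g)
                   (conj-intertwines y injy g) a₀ (y a₀) (a₀ , refl) refl i)
                (trans (cong y gⁱa₀≡a) ya≡τ)

theorem9 : (k : ℕ) (A : Set) → Countable A →
    (x y : A → Tape k) → IsRepresentation x → IsRepresentation y →
    ((g : A → A) → InComp x g → InComp y g) →
    CE (Image x) → CE (Image y)
theorem9 k A _ x y injx injy comp⊆ x-ce
  with ce⇒enumerating-comp x injx x-ce
... | g , a₀ , g∈comp-x , g-enum =
  enumerating-comp⇒ce y injy g a₀ (comp⊆ g g∈comp-x) g-enum
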